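{- Let $k\geq 1$ be an integer with $k\neq 2$, write $k=2p+1$ or $k=2p$ with $p$ an integer, and define $L:\mathbb{Z}\times\mathbb{Z}\to\mathbb{Z}$ of the form $L(x,y)=(ax+by)\bmod c$ (least non-negative residue) by: \begin{itemize} \item if $k=2p+1$ and $p\geq 1$ is odd: $a=2p+3$, $b=3p^2+7p+5$, $c=\frac{1}{2}(p+1)(3p^2+5p+4)$; \item if $k=2p+1$ and $p\geq 0$ is even: $a=2p+3$, $b=3p^2+6p+3$, $c=\frac{1}{2}(3p^3+8p^2+8p+4)$; \item if $k=2p$ and $p\geq 3$ is odd: $a=2p+1$, $b=3p^2+4p+2$, $c=\frac{1}{2}(3p^3+5p^2+5p+1)$; \item if $k=2p$ and $p\geq 2$ is even: $a=2p+1$, $b=3p^2+3p+1$, $c=\frac{1}{2}p(3p^2+5p+4)$. \end{itemize} Then $L$ is a no-hole labeling: every integer in $\{0,1,\ldots,c-1\}$ equals $L(x,y)$ for some $(x,y)\in\mathbb{Z}\times\mathbb{Z}$.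
   Context: A labeling with labels in $\{0,\ldots,\lambda-1\}$ is called no-hole if each label from $0$ to $\lambda-1$ is used at least once. -}

module Defs where

open import Data.Nat as ℕ using (ℕ; zero; suc; _∸_; _/_; _%_)
open import Data.Nat.Properties using (_≟_)
open import Data.Integer as ℤ using (ℤ; +_)
open import Data.Integer.DivMod using (_%ℕ_)
open import Data.Product using (_×_; _,_)
open import Relation.Nullary using (yes; no)

params : ℕ → ℕ × ℕ × ℕ
params k with k % 2 ≟ 0 | (k / 2) % 2 ≟ 0
... | no _  | no _  = let p = k / 2 in
    (2 ℕ.* p ℕ.+ 3 , 3 ℕ.* p ℕ.* p ℕ.+ 7 ℕ.* p ℕ.+ 5 ,
     ((p ℕ.+ 1) ℕ.* (3 ℕ.* p ℕ.* p ℕ.+ 5 ℕ.* p ℕ.+ 4)) / 2)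
... | no _  | yes _ = let p = k / 2 in
    (2 ℕ.* p ℕ.+ 3 , 3 ℕ.* p ℕ.* p ℕ.+ 6 ℕ.* p ℕ.+ 3 ,
     (3 ℕ.* p ℕ.* p ℕ.* p ℕ.+ 8 ℕ.* p ℕ.* p ℕ.+ 8 ℕ.* p ℕ.+ 4) / 2)
... | yes _ | no _  = let p = k / 2 in
    (2 ℕ.* p ℕ.+ 1 , 3 ℕ.* p ℕ.* p ℕ.+ 4 ℕ.* p ℕ.+ 2 ,
     (3 ℕ.* p ℕ.* p ℕ.* p ℕ.+ 5 ℕ.* p ℕ.* p ℕ.+ 5 ℕ.* p ℕ.+ 1) / 2)
... | yes _ | yes _ = let p = k / 2 in
    (2 ℕ.* p ℕ.+ 1 , 3 ℕ.* p ℕ.* p ℕ.+ 3 ℕ.* p ℕ.+ 1 ,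
     (p ℕ.* (3 ℕ.* p ℕ.* p ℕ.+ 5 ℕ.* p ℕ.+ 4)) / 2)

A B C : ℕ → ℕ
A k with params k
... | (a , _ , _) = a
B k with params k
... | (_ , b , _) = b
C k with params k
... | (_ , _ , c) = c

-- The modulus is written suc (C k ∸ 1), which equals C k since C k ≥ 2 for every
-- k ≥ 1 with k ≠ 2 (this only supplies the NonZero instance).
L : ℕ → ℤ → ℤ → ℕ
L k x y = ((+ A k) ℤ.* x ℤ.+ (+ B k) ℤ.* y) %ℕ suc (C k ∸ 1)

-- Each (a, b, c) admits explicit x₀, y₀, t with a x₀ + b y₀ = 1 + t c (a polynomial identity
-- in q, where k = 4q + r), so L(x₀, y₀) = 1 and hence L(m x₀, m y₀) = m for every m < c.
module Submission where

open import Defs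
open import Data.Nat using (ℕ; _≤_; _<_; zero; suc; _+_; _*_; _/_; _%_; s≤s; z≤n)
open import Data.Nat.DivMod using ([m+kn]%n≡m%n; m<n⇒m%n≡m; m*n/n≡m; +-distrib-/)
open import Data.Nat.Properties using (_≟_)
open import Data.Nat.Tactic.RingSolver using (solve-∀)
open import Data.Integer as ℤ using (+_)
open import Data.Integer.Properties using (pos-+; pos-*)
open import Data.Product using (∃-syntax; _,_)
open import Relation.Binary.PropositionalEquality
  using (_≡_; _≢_; refl; sym; trans; cong; module ≡-Reasoning)
open import Relation.Nullary using (yes; no; contradiction)

bezout-scaled-%ℕ : ∀ {a b n x y t} m → m < suc n → a * x + b * y ≡ 1 + t * suc n →
  ((+ a) ℤ.* (+ (m * x)) ℤ.+ (+ b) ℤ.* (+ (m * y))) ℤ.%ℕ suc n ≡ m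
bezout-scaled-%ℕ {a} {b} {n} {x} {y} {t} m m<c bez
  rewrite sym (pos-* a (m * x)) | sym (pos-* b (m * y)) | sym (pos-+ (a * (m * x)) (b * (m * y)))
  = begin
    (a * (m * x) + b * (m * y)) % suc n ≡⟨ cong (_% suc n) (factor-m a b m x y) ⟩
    (m * (a * x + b * y)) % suc n       ≡⟨ cong (λ s → (m * s) % suc n) bez ⟩
    (m * (1 + t * suc n)) % suc n       ≡⟨ cong (_% suc n) (expand-m m t (suc n)) ⟩
    (m + m * t * suc n) % suc n         ≡⟨ [m+kn]%n≡m%n m (m * t) (suc n) ⟩
    m % suc n                           ≡⟨ m<n⇒m%n≡m m<c ⟩
    m                                   ∎
  where
  open ≡-Reasoning
  factor-m : ∀ a b m x y → a * (m * x) + b * (m * y) ≡ m * (a * x + b * y)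
  factor-m = solve-∀
  expand-m : ∀ m t c → m * (1 + t * c) ≡ m + m * t * c
  expand-m = solve-∀

L-onto-of-bezout : ∀ {k a b c} → params k ≡ (a , b , c) →
  ∃[ x ] ∃[ y ] ∃[ t ] (a * x + b * y ≡ 1 + t * c) →
  ∀ m → m < C k → ∃[ x ] ∃[ y ] (L k x y ≡ m)
L-onto-of-bezout {c = zero} eq _ m m<C rewrite eq with () ← m<C
L-onto-of-bezout {a = a} {b} {suc n} eq (x , y , t , bez) m m<C rewrite eq =
  + (m * x) , + (m * y) , bezout-scaled-%ℕ {a} {b} {t = t} m m<C bez

-- Indices are written as k = 2p + 1 or k = 2p with p = 2q + 1 or p = 2q, the paper's four cases.
data Mod4 : ℕ → Set where
  4q   : ∀ q → Mod4 ((q * 2) * 2)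
  4q+1 : ∀ q → Mod4 (1 + (q * 2) * 2)
  4q+2 : ∀ q → Mod4 ((1 + q * 2) * 2)
  4q+3 : ∀ q → Mod4 (1 + (1 + q * 2) * 2)

mod4 : ∀ k → Mod4 k
mod4 zero = 4q 0
mod4 (suc k) with mod4 k
... | 4q q   = 4q+1 q
... | 4q+1 q = 4q+2 q
... | 4q+2 q = 4q+3 q
... | 4q+3 q = 4q (suc q)

even-%2 : ∀ p → (p * 2) % 2 ≡ 0
even-%2 p = [m+kn]%n≡m%n 0 p 2

odd-%2≢0 : ∀ p → (1 + p * 2) % 2 ≢ 0
odd-%2≢0 p odd≡0 with () ← trans (sym ([m+kn]%n≡m%n 1 p 2)) odd≡0

even-/2 : ∀ p → (p * 2) / 2 ≡ p
even-/2 p = m*n/n≡m p 2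

odd-/2 : ∀ p → (1 + p * 2) / 2 ≡ p
odd-/2 p = trans (+-distrib-/ 1 (p * 2) no-carry) (even-/2 p)
  where
  no-carry : 1 % 2 + (p * 2) % 2 < 2
  no-carry rewrite even-%2 p = s≤s (s≤s z≤n)

half-of-double : ∀ {n m} → n ≡ m * 2 → n / 2 ≡ m
half-of-double {m = m} refl = m*n/n≡m m 2

params-4q+3 : ∀ q → let p = 1 + q * 2 in
  params (1 + p * 2) ≡
    (2 * p + 3 , 3 * p * p + 7 * p + 5 , 12 * q * q * q + 34 * q * q + 34 * q + 12)
params-4q+3 q with (1 + (1 + q * 2) * 2) % 2 ≟ 0 | ((1 + (1 + q * 2) * 2) / 2) % 2 ≟ 0
... | yes k-even | _ = contradiction k-even (odd-%2≢0 (1 + q * 2))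
... | no _ | yes p-even =
  contradiction (trans (cong (_% 2) (sym (odd-/2 (1 + q * 2)))) p-even) (odd-%2≢0 q)
... | no _ | no _ rewrite odd-/2 (1 + q * 2) =
  cong (λ c → 2 * p + 3 , 3 * p * p + 7 * p + 5 , c) (half-of-double (c-formula q))
  where
  p = 1 + q * 2
  c-formula : ∀ q → let p = 1 + q * 2 in
    (p + 1) * (3 * p * p + 5 * p + 4) ≡ (12 * q * q * q + 34 * q * q + 34 * q + 12) * 2
  c-formula = solve-∀

params-4q+1 : ∀ q → let p = q * 2 in
  params (1 + p * 2) ≡
    (2 * p + 3 , 3 * p * p + 6 * p + 3 , 12 * q * q * q + 16 * q * q + 8 * q + 2)
params-4q+1 q with (1 + (q * 2) * 2) % 2 ≟ 0 | ((1 + (q * 2) * 2) / 2) % 2 ≟ 0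
... | yes k-even | _ = contradiction k-even (odd-%2≢0 (q * 2))
... | no _ | no p-odd =
  contradiction (trans (cong (_% 2) (odd-/2 (q * 2))) (even-%2 q)) p-odd
... | no _ | yes _ rewrite odd-/2 (q * 2) =
  cong (λ c → 2 * p + 3 , 3 * p * p + 6 * p + 3 , c) (half-of-double (c-formula q))
  where
  p = q * 2
  c-formula : ∀ q → let p = q * 2 in
    3 * p * p * p + 8 * p * p + 8 * p + 4 ≡ (12 * q * q * q + 16 * q * q + 8 * q + 2) * 2
  c-formula = solve-∀

params-4q+2 : ∀ q → let p = 1 + q * 2 in
  params (p * 2) ≡
    (2 * p + 1 , 3 * p * p + 4 * p + 2 , 12 * q * q * q + 28 * q * q + 24 * q + 7)
params-4q+2 q with ((1 + q * 2) * 2) % 2 ≟ 0 | (((1 + q * 2) * 2) / 2) % 2 ≟ 0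
... | no k-odd | _ = contradiction (even-%2 (1 + q * 2)) k-odd
... | yes _ | yes p-even =
  contradiction (trans (cong (_% 2) (sym (even-/2 (1 + q * 2)))) p-even) (odd-%2≢0 q)
... | yes _ | no _ rewrite even-/2 (1 + q * 2) =
  cong (λ c → 2 * p + 1 , 3 * p * p + 4 * p + 2 , c) (half-of-double (c-formula q))
  where
  p = 1 + q * 2
  c-formula : ∀ q → let p = 1 + q * 2 in
    3 * p * p * p + 5 * p * p + 5 * p + 1 ≡ (12 * q * q * q + 28 * q * q + 24 * q + 7) * 2
  c-formula = solve-∀

params-4q : ∀ q → let p = q * 2 in
  params (p * 2) ≡
    (2 * p + 1 , 3 * p * p + 3 * p + 1 , 12 * q * q * q + 10 * q * q + 4 * q)
params-4q q with ((q * 2) * 2) % 2 ≟ 0 | (((q * 2) * 2) / 2) % 2 ≟ 0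
... | no k-odd | _ = contradiction (even-%2 (q * 2)) k-odd
... | yes _ | no p-odd =
  contradiction (trans (cong (_% 2) (even-/2 (q * 2))) (even-%2 q)) p-odd
... | yes _ | yes _ rewrite even-/2 (q * 2) =
  cong (λ c → 2 * p + 1 , 3 * p * p + 3 * p + 1 , c) (half-of-double (c-formula q))
  where
  p = q * 2
  c-formula : ∀ q → let p = q * 2 in
    p * (3 * p * p + 5 * p + 4) ≡ (12 * q * q * q + 10 * q * q + 4 * q) * 2
  c-formula = solve-∀

bezout-4q+3 : ∀ q → let p = 1 + q * 2 in
  ∃[ x ] ∃[ y ] ∃[ t ] ((2 * p + 3) * x + (3 * p * p + 7 * p + 5) * y
                        ≡ 1 + t * (12 * q * q * q + 34 * q * q + 34 * q + 12))
bezout-4q+3 q =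
  12 * q * q * q + 34 * q * q + 31 * q + 8 , 12 * q * q * q + 34 * q * q + 31 * q + 11 ,
  12 * q * q + 30 * q + 17 , identity q
  where
  identity : ∀ q → let p = 1 + q * 2 in
    (2 * p + 3) * (12 * q * q * q + 34 * q * q + 31 * q + 8)
      + (3 * p * p + 7 * p + 5) * (12 * q * q * q + 34 * q * q + 31 * q + 11)
    ≡ 1 + (12 * q * q + 30 * q + 17) * (12 * q * q * q + 34 * q * q + 34 * q + 12)
  identity = solve-∀

bezout-4q+1 : ∀ q → let p = q * 2 in
  ∃[ x ] ∃[ y ] ∃[ t ] ((2 * p + 3) * x + (3 * p * p + 6 * p + 3) * y
                        ≡ 1 + t * (12 * q * q * q + 16 * q * q + 8 * q + 2))
bezout-4q+1 q =
  12 * q * q * q + 16 * q * q + 6 * q + 1 , 12 * q * q * q + 16 * q * q + 6 * q + 2 ,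
  12 * q * q + 16 * q + 4 , identity q
  where
  identity : ∀ q → let p = q * 2 in
    (2 * p + 3) * (12 * q * q * q + 16 * q * q + 6 * q + 1)
      + (3 * p * p + 6 * p + 3) * (12 * q * q * q + 16 * q * q + 6 * q + 2)
    ≡ 1 + (12 * q * q + 16 * q + 4) * (12 * q * q * q + 16 * q * q + 8 * q + 2)
  identity = solve-∀

bezout-4q+2 : ∀ q → let p = 1 + q * 2 in
  ∃[ x ] ∃[ y ] ∃[ t ] ((2 * p + 1) * x + (3 * p * p + 4 * p + 2) * y
                        ≡ 1 + t * (12 * q * q * q + 28 * q * q + 24 * q + 7))
bezout-4q+2 q = 12 * q * q * q + 28 * q * q + 22 * q + 6 , 2 * q + 2 , 4 * q + 5 , identity q
  where
  identity : ∀ q → let p = 1 + q * 2 in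
    (2 * p + 1) * (12 * q * q * q + 28 * q * q + 22 * q + 6) + (3 * p * p + 4 * p + 2) * (2 * q + 2)
    ≡ 1 + (4 * q + 5) * (12 * q * q * q + 28 * q * q + 24 * q + 7)
  identity = solve-∀

bezout-4q : ∀ q → let p = q * 2 in
  ∃[ x ] ∃[ y ] ∃[ t ] ((2 * p + 1) * x + (3 * p * p + 3 * p + 1) * y
                        ≡ 1 + t * (12 * q * q * q + 10 * q * q + 4 * q))
bezout-4q q = 2 * q + 1 , 2 * q , 2 , identity q
  where
  identity : ∀ q → let p = q * 2 in
    (2 * p + 1) * (2 * q + 1) + (3 * p * p + 3 * p + 1) * (2 * q)
    ≡ 1 + 2 * (12 * q * q * q + 10 * q * q + 4 * q)
  identity = solve-∀

lemma4 : (k : ℕ) → 1 ≤ k → k ≢ 2 →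
    (m : ℕ) → m < C k → ∃[ x ] ∃[ y ] (L k x y ≡ m)
lemma4 k _ _ with mod4 k
... | 4q q   = L-onto-of-bezout (params-4q q) (bezout-4q q)
... | 4q+1 q = L-onto-of-bezout (params-4q+1 q) (bezout-4q+1 q)
... | 4q+2 q = L-onto-of-bezout (params-4q+2 q) (bezout-4q+2 q)
... | 4q+3 q = L-onto-of-bezout (params-4q+3 q) (bezout-4q+3 q)
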